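{- Let $G$ and $H$ be connected graphs, each with at least $2$ vertices. Then the Cartesian product $G\Box H$ is well-edge-dominated if and only if $G\Box H = K_2\Box K_2$ (i.e. both $G$ and $H$ are $K_2$).
   Context: All graphs are finite and simple. The Cartesian product $G\Box H$ has vertex set $V(G)\times V(H)$, with $(g_1,h_1)$ adjacent to $(g_2,h_2)$ iff either $g_1=g_2$ and $h_1h_2\in E(H)$, or $h_1=h_2$ and $g_1g_2\in E(G)$. A set $F$ of edges is an edge dominating set if every edge not in $F$ shares an endpoint with some edge of $F$; it is minimal if no proper subset is an edge dominating set. A graph is well-edge-dominated if all its minimal edge dominating sets have the same cardinality. -}

module Defs where

open import Data.Nat using (ℕ; zero; suc; _*_; _≥_)
open import Data.Fin using (Fin; toℕ; remQuot; zero; suc)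
open import Data.Fin.Properties using (_≟_)
open import Data.Bool using (Bool; true; false; _∧_; _∨_; if_then_else_; not)
open import Data.Nat using (_<ᵇ_)
open import Data.List using (List; map; allFin)
open import Data.Nat.ListAction using (sum)
open import Data.Product using (Σ; _×_; _,_; ∃-syntax)
open import Data.Sum using (_⊎_)
open import Relation.Nullary using (¬_; does)
open import Relation.Binary.PropositionalEquality using (_≡_)
open import Relation.Binary.Construct.Closure.ReflexiveTransitive using (Star)
open import Function.Bundles using (_↔_; Inverse)

record Graph : Set where
  constructor mkGraph
  field
    n   : ℕ
    adj : Fin n → Fin n → Bool
open Graph public

record IsSimple (G : Graph) : Set where
  field
    irrefl : ∀ u → adj G u u ≡ false
    sym    : ∀ u v → adj G u v ≡ adj G v u
open IsSimple public

Adjacent : (G : Graph) → Fin (n G) → Fin (n G) → Set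
Adjacent G u v = adj G u v ≡ true

Connected : Graph → Set
Connected G = ∀ u v → Star (Adjacent G) u v

K₂ : Graph
K₂ = mkGraph 2 (λ u v → not (does (u ≟ v)))

_≅_ : Graph → Graph → Set
G ≅ H = Σ (Fin (n G) ↔ Fin (n H)) λ f →
          ∀ u v → adj H (Inverse.to f u) (Inverse.to f v) ≡ adj G u v

_□_ : Graph → Graph → Graph
G □ H = mkGraph (n G * n H) A
  where
  A : Fin (n G * n H) → Fin (n G * n H) → Bool
  A x y with remQuot {n G} (n H) x | remQuot {n G} (n H) y
  ... | (g₁ , h₁) | (g₂ , h₂) =
        (does (g₁ ≟ g₂) ∧ adj H h₁ h₂) ∨ (does (h₁ ≟ h₂) ∧ adj G g₁ g₂)

EdgeSet : Graph → Set
EdgeSet G = Fin (n G) → Fin (n G) → Bool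

record IsEdgeSet (G : Graph) (F : EdgeSet G) : Set where
  field
    sub : ∀ u v → F u v ≡ true → adj G u v ≡ true
    sym : ∀ u v → F u v ≡ F v u

-- Number of edges in F (each unordered pair {u,v} counted once, via u < v).
size : (G : Graph) → EdgeSet G → ℕ
size G F = sum (map (λ u → sum (map (λ v →
             if (toℕ u <ᵇ toℕ v) ∧ F u v then 1 else 0) (allFin (n G)))) (allFin (n G)))

IsEDS : (G : Graph) → EdgeSet G → Set
IsEDS G F = IsEdgeSet G F ×
  (∀ u v → adj G u v ≡ true → F u v ≡ false →
     ∃[ w ] (F u w ≡ true ⊎ F v w ≡ true))

_⊆E_ : {G : Graph} → EdgeSet G → EdgeSet G → Set
F' ⊆E F = ∀ u v → F' u v ≡ true → F u v ≡ true

IsMinimalEDS : (G : Graph) → EdgeSet G → Set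
IsMinimalEDS G F = IsEDS G F ×
  (∀ F' → IsEdgeSet G F' → _⊆E_ {G} F' F → ¬ (∀ u v → F' u v ≡ F u v) → ¬ IsEDS G F')

WellEdgeDominated : Graph → Set
WellEdgeDominated G = ∀ F F' → IsMinimalEDS G F → IsMinimalEDS G F' → size G F ≡ size G F'

-- A maximal matching is a minimal edge dominating set, so it suffices to exhibit two maximal
-- matchings of different sizes in G □ H whenever G has a path g₁g₂g₃ and H an edge h₁h₂;
-- for connected graphs on at least two vertices this fails only for G = H = K₂, and
-- K₂ □ K₂ = C₄ is checked by enumeration.
-- On the strip G × {h₁,h₂} one matching takes the three rungs (gᵢ,h₁)(gᵢ,h₂), the other the
-- staircase (g₁,h₁)(g₂,h₁), (g₂,h₂)(g₃,h₂), which leaves the corners (g₃,h₁) and (g₁,h₂)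
-- uncovered. Both are completed by the rungs of the remaining columns and by one maximal
-- matching of the graph off the strip. The staircase matching is maximal provided the off-strip
-- neighbours (g₃,h) and (g₁,h) of the corners are covered, so in every layer h adjacent to h₁ or
-- h₂ a suitable edge among g₁, g₂, g₃ is matched in advance. If h is adjacent to both, that edge
-- must be g₁g₃; when g₁g₃ ∉ E(G), the path h₁hh₂ of H and the edge g₁g₂ of G are used instead,
-- and for them the corresponding condition holds because h₁h₂ ∈ E(H).

module Submission where

open import Defs
open import Data.Nat using (ℕ; zero; suc; _+_; _*_; _≥_; _<ᵇ_; s≤s)
import Data.Nat as Nat
open import Data.Nat.Properties using (+-identityʳ; +-commutativeSemigroup; +-cancelʳ-≡; <-cmp; <ᵇ⇒<; <⇒<ᵇ; <-asym; ≤-trans; n≤1+n; ≤∧≢⇒<)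
open import Data.Nat.ListAction using (sum)
open import Algebra.Properties.CommutativeSemigroup +-commutativeSemigroup using (interchange)
open import Data.Fin using (Fin; toℕ; zero; suc; remQuot; combine)
open import Data.Fin.Properties using (_≟_; toℕ-injective; any?; all?; ¬∀⟶∃¬; remQuot-combine; combine-remQuot)
open import Data.Fin.Permutation using (↔⇒≡)
open import Data.Fin.Patterns using (0F; 1F; 2F; 3F)
open import Data.Bool using (Bool; true; false; _∧_; _∨_; if_then_else_; not; T)
import Data.Bool.Properties as Bool
open import Data.List using (List; []; _∷_; map; allFin)
open import Data.List.Properties using (map-cong; map-tabulate)
open import Data.List.Membership.Propositional using (_∈_)
open import Data.List.Membership.Propositional.Properties using (∈-allFin)
open import Data.List.Relation.Unary.Any using (here; there)
open import Data.Product using (Σ; _×_; _,_; ∃; ∃₂; ∃-syntax; proj₁; proj₂; swap)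
open import Data.Sum using (_⊎_; inj₁; inj₂; [_,_]′) renaming (swap to ⊎-swap)
open import Data.Empty using (⊥; ⊥-elim)
open import Data.Unit using (tt)
open import Function.Bundles using (_⇔_; mk⇔)
open import Function.Construct.Identity using (↔-id)
open import Relation.Nullary using (¬_; Dec; yes; no; does)
open import Relation.Nullary.Decidable using (map′; dec-true; does-⇔; True; False; toWitness; toWitnessFalse; _×-dec_; _⊎-dec_; _→-dec_; ¬?)
open import Relation.Binary.PropositionalEquality using (_≡_; _≢_; refl; cong; cong₂; subst; trans; ≢-sym; module ≡-Reasoning)
import Relation.Binary.PropositionalEquality as ≡
open import Relation.Binary.Definitions using (tri<; tri≈; tri>)
open import Relation.Binary.Construct.Closure.ReflexiveTransitive using (Star; ε; _◅_)

∧-true : ∀ {a b} → a ∧ b ≡ true → a ≡ true × b ≡ true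
∧-true {true} {true} refl = refl , refl

∨-true : ∀ {a b} → a ∨ b ≡ true → a ≡ true ⊎ b ≡ true
∨-true {true} _ = inj₁ refl
∨-true {false} {true} _ = inj₂ refl

∨-trueˡ : ∀ {a} b → a ≡ true → a ∨ b ≡ true
∨-trueˡ b refl = refl

∨-trueʳ : ∀ a {b} → b ≡ true → a ∨ b ≡ true
∨-trueʳ true _ = refl
∨-trueʳ false refl = refl

true≢false : true ≢ false
true≢false ()

≢true⇒false : ∀ {a} → a ≢ true → a ≡ false
≢true⇒false = Bool.¬-not

implied-difference : ∀ {a b} → (a ≡ true → b ≡ true) → a ≢ b → a ≡ false × b ≡ true
implied-difference {false} {true} _ _ = refl , refl
implied-difference {false} {false} _ a≢b = ⊥-elim (a≢b refl)
implied-difference {true} {b} a⇒b a≢b = ⊥-elim (a≢b (≡.sym (a⇒b refl)))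

does-true⇒ : ∀ {A : Set} (a? : Dec A) → does a? ≡ true → A
does-true⇒ (yes a) _ = a

sum-map-+ : ∀ {A : Set} (f g : A → ℕ) xs →
            sum (map (λ x → f x + g x) xs) ≡ sum (map f xs) + sum (map g xs)
sum-map-+ f g [] = refl
sum-map-+ f g (x ∷ xs) = begin
  (f x + g x) + sum (map (λ x → f x + g x) xs)   ≡⟨ cong ((f x + g x) +_) (sum-map-+ f g xs) ⟩
  (f x + g x) + (sum (map f xs) + sum (map g xs)) ≡⟨ interchange (f x) (g x) _ _ ⟩
  (f x + sum (map f xs)) + (g x + sum (map g xs)) ∎
  where open ≡-Reasoning

sum-map-0 : ∀ {A : Set} (xs : List A) → sum (map (λ _ → 0) xs) ≡ 0
sum-map-0 [] = refl
sum-map-0 (x ∷ xs) = sum-map-0 xs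

sum-if : ∀ {A : Set} c (f : A → ℕ) xs →
         sum (map (λ x → if c then f x else 0) xs) ≡ (if c then sum (map f xs) else 0)
sum-if true f xs = refl
sum-if false f xs = sum-map-0 xs

sum-allFin-suc : ∀ {m} (f : Fin (suc m) → ℕ) →
                 sum (map f (allFin (suc m))) ≡ f zero + sum (map (λ x → f (suc x)) (allFin m))
sum-allFin-suc {m} f = cong (λ xs → f zero + sum xs)
  (trans (map-tabulate suc f) (≡.sym (map-tabulate (λ x → x) (λ x → f (suc x)))))

sum-allFin-indicator : ∀ m (c : Fin m) k →
                       sum (map (λ x → if does (x ≟ c) then k else 0) (allFin m)) ≡ k
sum-allFin-indicator (suc m) zero k =
  trans (sum-allFin-suc {m} (λ x → if does (x ≟ zero) then k else 0))
        (trans (cong (k +_) (sum-map-0 (allFin m))) (+-identityʳ k))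
sum-allFin-indicator (suc m) (suc c) k =
  trans (sum-allFin-suc {m} (λ x → if does (x ≟ suc c) then k else 0)) (sum-allFin-indicator m c k)

Pair : ∀ {m} → Fin m → Fin m → Fin m → Fin m → Set
Pair a b u v = (u ≡ a × v ≡ b) ⊎ (u ≡ b × v ≡ a)

pair? : ∀ {m} (a b u v : Fin m) → Dec (Pair a b u v)
pair? a b u v = ((u ≟ a) ×-dec (v ≟ b)) ⊎-dec ((u ≟ b) ×-dec (v ≟ a))

module _ {m} {a b : Fin m} where

  Pair-sym : ∀ {u v} → Pair a b u v → Pair a b v u
  Pair-sym (inj₁ (p , q)) = inj₂ (q , p)
  Pair-sym (inj₂ (p , q)) = inj₁ (q , p)

  Pair-functional : a ≢ b → ∀ {u v w} → Pair a b u v → Pair a b u w → v ≡ w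
  Pair-functional a≢b (inj₁ (_ , refl)) (inj₁ (_ , refl)) = refl
  Pair-functional a≢b (inj₂ (_ , refl)) (inj₂ (_ , refl)) = refl
  Pair-functional a≢b (inj₁ (refl , _)) (inj₂ (u≡b , _)) = ⊥-elim (a≢b u≡b)
  Pair-functional a≢b (inj₂ (refl , _)) (inj₁ (u≡a , _)) = ⊥-elim (a≢b (≡.sym u≡a))

  Pair-endpoint : ∀ {u v} → Pair a b u v → u ≡ a ⊎ u ≡ b
  Pair-endpoint (inj₁ (p , _)) = inj₁ p
  Pair-endpoint (inj₂ (p , _)) = inj₂ p

  Pair-related : (R : Fin m → Fin m → Bool) → (∀ x y → R x y ≡ R y x) →
                 R a b ≡ true → ∀ {u v} → Pair a b u v → R u v ≡ true
  Pair-related R R-sym Rab (inj₁ (refl , refl)) = Rab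
  Pair-related R R-sym Rab (inj₂ (refl , refl)) = trans (R-sym b a) Rab

module EdgeSets (Γ : Graph) (Γ-simple : IsSimple Γ) where

  V : Set
  V = Fin (n Γ)

  _∪_ : EdgeSet Γ → EdgeSet Γ → EdgeSet Γ
  (F ∪ F') x y = F x y ∨ F' x y

  edgesOf : {R : V → V → Set} → (∀ x y → Dec (R x y)) → EdgeSet Γ
  edgesOf R? x y = does (R? x y)

  edge : V → V → EdgeSet Γ
  edge a b = edgesOf (pair? a b)

  record Covers (F : EdgeSet Γ) (u : V) : Set where
    constructor covered
    field
      {partner} : V
      edge∈ : F u partner ≡ true

  covers? : ∀ F x → Dec (Covers F x)
  covers? F x = map′ (λ (_ , p) → covered p) (λ (covered p) → _ , p) (any? (λ w → F x w Bool.≟ true))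

  Disjoint : EdgeSet Γ → EdgeSet Γ → Set
  Disjoint F F' = ∀ x → Covers F x → Covers F' x → ⊥

  IsMatching : EdgeSet Γ → Set
  IsMatching F = IsEdgeSet Γ F × (∀ u v w → F u v ≡ true → F u w ≡ true → v ≡ w)

  Maximal : EdgeSet Γ → Set
  Maximal F = ∀ u v → Adjacent Γ u v → Covers F u ⊎ Covers F v

  adjacent⇒≢ : ∀ {u v} → Adjacent Γ u v → u ≢ v
  adjacent⇒≢ {u} uv refl = true≢false (trans (≡.sym uv) (irrefl Γ-simple u))

  covers-mono : ∀ {F F'} → _⊆E_ {Γ} F F' → ∀ {u} → Covers F u → Covers F' u
  covers-mono F⊆F' (covered p) = covered (F⊆F' _ _ p)

  covers-∪ : ∀ F F' {x} → Covers (F ∪ F') x → Covers F x ⊎ Covers F' x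
  covers-∪ F F' {x} (covered {w} p) with ∨-true {F x w} p
  ... | inj₁ q = inj₁ (covered q)
  ... | inj₂ q = inj₂ (covered q)

  covers-∪ˡ : ∀ F F' {x} → Covers F x → Covers (F ∪ F') x
  covers-∪ˡ F F' {x} (covered {w} p) = covered (∨-trueˡ (F' x w) p)

  covers-∪ʳ : ∀ F F' {x} → Covers F' x → Covers (F ∪ F') x
  covers-∪ʳ F F' {x} (covered {w} p) = covered (∨-trueʳ (F x w) p)

  covers-edgesOf : ∀ {R : V → V → Set} (R? : ∀ x y → Dec (R x y)) {x} → Covers (edgesOf R?) x → ∃ (R x)
  covers-edgesOf R? {x} (covered {w} p) = w , does-true⇒ (R? x w) p

  edgesOf-covers : ∀ {R : V → V → Set} (R? : ∀ x y → Dec (R x y)) {x y} → R x y → Covers (edgesOf R?) x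
  edgesOf-covers R? {x} {y} r = covered (dec-true (R? x y) r)

  covers-edge : ∀ a b {x} → Covers (edge a b) x → x ≡ a ⊎ x ≡ b
  covers-edge a b c = Pair-endpoint (proj₂ (covers-edgesOf (pair? a b) c))

  edge-coversˡ : ∀ a b → Covers (edge a b) a
  edge-coversˡ a b = edgesOf-covers (pair? a b) (inj₁ (refl , refl))

  edge-coversʳ : ∀ a b → Covers (edge a b) b
  edge-coversʳ a b = edgesOf-covers (pair? a b) (inj₂ (refl , refl))

  edgesOf-isMatching : ∀ {R : V → V → Set} (R? : ∀ x y → Dec (R x y)) →
    (∀ {x y} → R x y → R y x) → (∀ {x y} → R x y → Adjacent Γ x y) →
    (∀ {x y z} → R x y → R x z → y ≡ z) → IsMatching (edgesOf R?)
  edgesOf-isMatching R? R-sym R⇒adj R-functional = isEdgeSet , functional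
    where
    isEdgeSet : IsEdgeSet Γ (edgesOf R?)
    isEdgeSet = record
      { sub = λ u v p → R⇒adj (does-true⇒ (R? u v) p)
      ; sym = λ u v → does-⇔ (mk⇔ R-sym R-sym) (R? u v) (R? v u)
      }
    functional : ∀ u v w → edgesOf R? u v ≡ true → edgesOf R? u w ≡ true → v ≡ w
    functional u v w p q = R-functional (does-true⇒ (R? u v) p) (does-true⇒ (R? u w) q)

  edge-isMatching : ∀ {a b} → Adjacent Γ a b → IsMatching (edge a b)
  edge-isMatching {a} {b} ab = edgesOf-isMatching (pair? a b) Pair-sym
    (Pair-related (adj Γ) (sym Γ-simple) ab) (Pair-functional (adjacent⇒≢ ab))

  ∪-isMatching : ∀ {F F'} → IsMatching F → IsMatching F' → Disjoint F F' → IsMatching (F ∪ F')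
  ∪-isMatching {F} {F'} (F-edges , F-fun) (F'-edges , F'-fun) disjoint = isEdgeSet , functional
    where
    isEdgeSet : IsEdgeSet Γ (F ∪ F')
    isEdgeSet = record
      { sub = λ u v p → [ IsEdgeSet.sub F-edges u v , IsEdgeSet.sub F'-edges u v ]′ (∨-true {F u v} p)
      ; sym = λ u v → cong₂ _∨_ (IsEdgeSet.sym F-edges u v) (IsEdgeSet.sym F'-edges u v)
      }
    functional : ∀ u v w → (F ∪ F') u v ≡ true → (F ∪ F') u w ≡ true → v ≡ w
    functional u v w p q with ∨-true {F u v} p | ∨-true {F u w} q
    ... | inj₁ p' | inj₁ q' = F-fun u v w p' q'
    ... | inj₂ p' | inj₂ q' = F'-fun u v w p' q'
    ... | inj₁ p' | inj₂ q' = ⊥-elim (disjoint u (covered p') (covered q'))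
    ... | inj₂ p' | inj₁ q' = ⊥-elim (disjoint u (covered q') (covered p'))

  -- size Γ F unfolds to the double sum over u and v of counted u v (F u v).
  counted : V → V → Bool → ℕ
  counted u v b = if (toℕ u <ᵇ toℕ v) ∧ b then 1 else 0

  size-cong : ∀ {F F'} → (∀ u v → F u v ≡ F' u v) → size Γ F ≡ size Γ F'
  size-cong F≗F' = cong sum (map-cong (λ u → cong sum (map-cong (λ v → cong (counted u v) (F≗F' u v))
                                                                 (allFin (n Γ))))
                                       (allFin (n Γ)))

  size-∪ : ∀ F F' → (∀ u v → F u v ≡ true → F' u v ≡ false) → size Γ (F ∪ F') ≡ size Γ F + size Γ F'
  size-∪ F F' disjoint = trans
    (cong sum (map-cong (λ u → trans
      (cong sum (map-cong (λ v → counted-∨ u v (disjoint u v)) (allFin (n Γ))))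
      (sum-map-+ (λ v → counted u v (F u v)) (λ v → counted u v (F' u v)) (allFin (n Γ))))
      (allFin (n Γ))))
    (sum-map-+ _ _ (allFin (n Γ)))
    where
    counted-∨ : ∀ u v {a b} → (a ≡ true → b ≡ false) → counted u v (a ∨ b) ≡ counted u v a + counted u v b
    counted-∨ u v {a} {b} a⇒¬b with toℕ u <ᵇ toℕ v | a
    ... | false | _ = refl
    ... | true | false = refl
    ... | true | true rewrite a⇒¬b refl = refl

  size-∪-disjoint : ∀ F F' → Disjoint F F' → size Γ (F ∪ F') ≡ size Γ F + size Γ F'
  size-∪-disjoint F F' disjoint = size-∪ F F' λ u v p → ≢true⇒false (λ q → disjoint u (covered p) (covered q))

  counted-false : ∀ u v → counted u v false ≡ 0
  counted-false u v with toℕ u <ᵇ toℕ v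
  ... | true = refl
  ... | false = refl

  ordered : V → V → ℕ
  ordered a b = if toℕ a <ᵇ toℕ b then 1 else 0

  ordered-+-flip : ∀ {a b} → a ≢ b → ordered a b + ordered b a ≡ 1
  ordered-+-flip {a} {b} a≢b with toℕ a <ᵇ toℕ b in ab | toℕ b <ᵇ toℕ a in ba
  ... | true | false = refl
  ... | false | true = refl
  ... | true | true = ⊥-elim (<-asym (<ᵇ⇒< (toℕ a) (toℕ b) (subst T (≡.sym ab) tt))
                                    (<ᵇ⇒< (toℕ b) (toℕ a) (subst T (≡.sym ba) tt)))
  ... | false | false with <-cmp (toℕ a) (toℕ b)
  ... | tri< a<b _ _ = ⊥-elim (subst T ab (<⇒<ᵇ a<b))
  ... | tri≈ _ a≡b _ = ⊥-elim (a≢b (toℕ-injective a≡b))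
  ... | tri> _ _ b<a = ⊥-elim (subst T ba (<⇒<ᵇ b<a))

  point : V → V → EdgeSet Γ
  point a b u v = does (u ≟ a) ∧ does (v ≟ b)

  size-point : ∀ a b → size Γ (point a b) ≡ ordered a b
  size-point a b = trans (cong sum (map-cong row (allFin (n Γ)))) (sum-allFin-indicator (n Γ) a (ordered a b))
    where
    counted-point : ∀ u v → counted u v (point a b u v)
                    ≡ (if does (u ≟ a) then (if does (v ≟ b) then ordered a b else 0) else 0)
    counted-point u v with u ≟ a | v ≟ b
    ... | no _ | _ = counted-false u v
    ... | yes _ | no _ = counted-false u v
    ... | yes refl | yes refl with toℕ u <ᵇ toℕ v
    ...   | true = refl
    ...   | false = refl
    row : ∀ u → sum (map (λ v → counted u v (point a b u v)) (allFin (n Γ))) ≡ (if does (u ≟ a) then ordered a b else 0)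
    row u = begin
      sum (map (λ v → counted u v (point a b u v)) (allFin (n Γ)))
        ≡⟨ cong sum (map-cong (counted-point u) (allFin (n Γ))) ⟩
      sum (map (λ v → if does (u ≟ a) then (if does (v ≟ b) then ordered a b else 0) else 0) (allFin (n Γ)))
        ≡⟨ sum-if (does (u ≟ a)) _ (allFin (n Γ)) ⟩
      (if does (u ≟ a) then sum (map (λ v → if does (v ≟ b) then ordered a b else 0) (allFin (n Γ))) else 0)
        ≡⟨ cong (λ k → if does (u ≟ a) then k else 0) (sum-allFin-indicator (n Γ) b (ordered a b)) ⟩
      (if does (u ≟ a) then ordered a b else 0) ∎
      where open ≡-Reasoning

  -- edge a b is, by unfolding, point a b ∪ point b a.
  size-edge : ∀ {a b} → a ≢ b → size Γ (edge a b) ≡ 1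
  size-edge {a} {b} a≢b = begin
    size Γ (point a b ∪ point b a)       ≡⟨ size-∪ (point a b) (point b a) disjoint ⟩
    size Γ (point a b) + size Γ (point b a) ≡⟨ cong₂ _+_ (size-point a b) (size-point b a) ⟩
    ordered a b + ordered b a            ≡⟨ ordered-+-flip a≢b ⟩
    1                                    ∎
    where
    open ≡-Reasoning
    disjoint : ∀ u v → point a b u v ≡ true → point b a u v ≡ false
    disjoint u v p with ∧-true {does (u ≟ a)} p
    ... | u≡a , _ = ≢true⇒false λ q →
      a≢b (trans (≡.sym (does-true⇒ (u ≟ a) u≡a)) (does-true⇒ (u ≟ b) (proj₁ (∧-true {does (u ≟ b)} q))))

  -- An edge of F missing from F' is not dominated by F'.
  maximalMatching⇒minimalEDS : ∀ {F} → IsMatching F → Maximal F → IsMinimalEDS Γ F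
  maximalMatching⇒minimalEDS {F} (F-edges , F-fun) maximal = (F-edges , dominating) , minimal
    where
    dominating : ∀ u v → Adjacent Γ u v → F u v ≡ false → ∃[ w ] (F u w ≡ true ⊎ F v w ≡ true)
    dominating u v uv _ with maximal u v uv
    ... | inj₁ (covered p) = _ , inj₁ p
    ... | inj₂ (covered p) = _ , inj₂ p
    missing-edge : ∀ {F'} → _⊆E_ {Γ} F' F → ¬ (∀ u v → F' u v ≡ F u v) →
                   ∃[ u ] ∃[ v ] (F u v ≡ true × F' u v ≡ false)
    missing-edge {F'} F'⊆F F'≢F
      with u , ¬row ← ¬∀⟶∃¬ (n Γ) _ (λ u → all? (λ v → F' u v Bool.≟ F u v)) F'≢F
      with v , F'uv≢Fuv ← ¬∀⟶∃¬ (n Γ) _ (λ v → F' u v Bool.≟ F u v) ¬row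
      = u , v , swap (implied-difference (F'⊆F u v) F'uv≢Fuv)
    at-endpoint : ∀ {F'} → _⊆E_ {Γ} F' F → ∀ {x y z} → F x y ≡ true → F' x z ≡ true → F' x y ≡ true
    at-endpoint {F'} F'⊆F {x} Fxy F'xz = subst (λ z → F' x z ≡ true) (≡.sym (F-fun _ _ _ Fxy (F'⊆F _ _ F'xz))) F'xz
    minimal : ∀ F' → IsEdgeSet Γ F' → _⊆E_ {Γ} F' F → ¬ (∀ u v → F' u v ≡ F u v) → ¬ IsEDS Γ F'
    minimal F' F'-edges F'⊆F F'≢F (_ , F'-dominating)
      with u , v , Fuv , F'uv ← missing-edge F'⊆F F'≢F
      with F'-dominating u v (IsEdgeSet.sub F-edges u v Fuv) F'uv
    ... | _ , inj₁ F'uw = true≢false (trans (≡.sym (at-endpoint F'⊆F Fuv F'uw)) F'uv)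
    ... | _ , inj₂ F'vw = true≢false (trans (≡.sym F'uv-true) F'uv)
      where
      F'uv-true : F' u v ≡ true
      F'uv-true = trans (IsEdgeSet.sym F'-edges u v)
        (at-endpoint F'⊆F (trans (≡.sym (IsEdgeSet.sym F-edges u v)) Fuv) F'vw)

  module GreedyOn (W : V → Set) (W? : ∀ u → Dec (W u)) where

    Within : EdgeSet Γ → Set
    Within F = ∀ u v → F u v ≡ true → W u × W v

    MaximalOn : EdgeSet Γ → Set
    MaximalOn F = ∀ u v → W u → W v → Adjacent Γ u v → Covers F u ⊎ Covers F v

    -- No edge at u can be added to F while keeping it a matching within W.
    Settled : EdgeSet Γ → V → Set
    Settled F u = ¬ W u ⊎ Covers F u ⊎ (∀ v → W v → Adjacent Γ u v → Covers F v)

    record Extension (F : EdgeSet Γ) (P : EdgeSet Γ → Set) : Set where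
      field
        edges      : EdgeSet Γ
        isMatching : IsMatching edges
        within     : Within edges
        extends    : _⊆E_ {Γ} F edges
        property   : P edges

    settled-mono : ∀ {F F'} → _⊆E_ {Γ} F F' → ∀ {u} → Settled F u → Settled F' u
    settled-mono F⊆F' (inj₁ ¬Wu) = inj₁ ¬Wu
    settled-mono F⊆F' (inj₂ (inj₁ c)) = inj₂ (inj₁ (covers-mono F⊆F' c))
    settled-mono F⊆F' (inj₂ (inj₂ h)) = inj₂ (inj₂ λ v Wv uv → covers-mono F⊆F' (h v Wv uv))

    unchanged : ∀ {F P} → IsMatching F → Within F → P F → Extension F P
    unchanged {F} F-matching F-within p = record
      { edges = F ; isMatching = F-matching ; within = F-within ; extends = λ _ _ q → q ; property = p }

    settle : ∀ {F} → IsMatching F → Within F → ∀ u → Extension F (λ F' → Settled F' u)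
    settle {F} F-matching F-within u with W? u | covers? F u
    ... | no ¬Wu | _ = unchanged F-matching F-within (inj₁ ¬Wu)
    ... | yes _ | yes c = unchanged F-matching F-within (inj₂ (inj₁ c))
    ... | yes Wu | no ¬c with any? (λ v → W? v ×-dec ((adj Γ u v Bool.≟ true) ×-dec ¬? (covers? F v)))
    ...   | no none = unchanged F-matching F-within (inj₂ (inj₂ all-covered))
      where
      all-covered : ∀ v → W v → Adjacent Γ u v → Covers F v
      all-covered v Wv uv with covers? F v
      ... | yes c = c
      ... | no ¬cv = ⊥-elim (none (v , Wv , uv , ¬cv))
    ...   | yes (v , Wv , uv , ¬cv) = record
      { edges = F ∪ edge u v
      ; isMatching = ∪-isMatching F-matching (edge-isMatching uv) disjoint
      ; within = within
      ; extends = λ x y p → ∨-trueˡ (edge u v x y) p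
      ; property = inj₂ (inj₁ (covers-∪ʳ F (edge u v) (edge-coversˡ u v)))
      }
      where
      disjoint : Disjoint F (edge u v)
      disjoint x c c' with covers-edge u v c'
      ... | inj₁ refl = ¬c c
      ... | inj₂ refl = ¬cv c
      within : Within (F ∪ edge u v)
      within x y p with ∨-true {F x y} p
      ... | inj₁ q = F-within x y q
      ... | inj₂ q with does-true⇒ (pair? u v x y) q
      ...   | inj₁ (refl , refl) = Wu , Wv
      ...   | inj₂ (refl , refl) = Wv , Wu

    settle-all : ∀ {F} → IsMatching F → Within F → ∀ us → Extension F (λ F' → ∀ u → u ∈ us → Settled F' u)
    settle-all F-matching F-within [] = unchanged F-matching F-within λ _ ()
    settle-all F-matching F-within (u ∷ us) = record
      { edges = E₂.edges ; isMatching = E₂.isMatching ; within = E₂.within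
      ; extends = λ x y p → E₂.extends x y (E₁.extends x y p)
      ; property = settled
      }
      where
      module E₁ = Extension (settle-all F-matching F-within us)
      module E₂ = Extension (settle E₁.isMatching E₁.within u)
      settled : ∀ w → w ∈ u ∷ us → Settled E₂.edges w
      settled w (here refl) = E₂.property
      settled w (there w∈us) = settled-mono E₂.extends (E₁.property w w∈us)

    extend-to-maximalOn : ∀ {F} → IsMatching F → Within F → Extension F MaximalOn
    extend-to-maximalOn F-matching F-within = record
      { edges = E.edges ; isMatching = E.isMatching ; within = E.within ; extends = E.extends
      ; property = maximal }
      where
      module E = Extension (settle-all F-matching F-within (allFin (n Γ)))
      maximal : MaximalOn E.edges
      maximal u v Wu Wv uv with E.property u (∈-allFin u)
      ... | inj₁ ¬Wu = ⊥-elim (¬Wu Wu)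
      ... | inj₂ (inj₁ c) = inj₁ c
      ... | inj₂ (inj₂ h) = inj₂ (h v Wv uv)

record ProductOf (Γ G H : Graph) : Set where
  field
    π₁ : Fin (n Γ) → Fin (n G)
    π₂ : Fin (n Γ) → Fin (n H)
    ι  : Fin (n G) → Fin (n H) → Fin (n Γ)
    π₁-ι : ∀ a b → π₁ (ι a b) ≡ a
    π₂-ι : ∀ a b → π₂ (ι a b) ≡ b
    ι-π  : ∀ x → ι (π₁ x) (π₂ x) ≡ x
    adjacent⇒ : ∀ {x y} → Adjacent Γ x y →
      (π₁ x ≡ π₁ y × Adjacent H (π₂ x) (π₂ y)) ⊎ (π₂ x ≡ π₂ y × Adjacent G (π₁ x) (π₁ y))
    ⇒adjacent : ∀ {x y} →
      (π₁ x ≡ π₁ y × Adjacent H (π₂ x) (π₂ y)) ⊎ (π₂ x ≡ π₂ y × Adjacent G (π₁ x) (π₁ y)) →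
      Adjacent Γ x y

ProductOf-swap : ∀ {Γ G H} → ProductOf Γ G H → ProductOf Γ H G
ProductOf-swap P = record
  { π₁ = π₂ ; π₂ = π₁ ; ι = λ b a → ι a b
  ; π₁-ι = λ b a → π₂-ι a b ; π₂-ι = λ b a → π₁-ι a b ; ι-π = ι-π
  ; adjacent⇒ = λ xy → ⊎-swap (adjacent⇒ xy) ; ⇒adjacent = λ h → ⇒adjacent (⊎-swap h)
  }
  where open ProductOf P

□-product : ∀ G H → ProductOf (G □ H) G H
□-product G H = record
  { π₁ = π₁ ; π₂ = π₂ ; ι = combine
  ; π₁-ι = λ a b → cong proj₁ (remQuot-combine a b)
  ; π₂-ι = λ a b → cong proj₂ (remQuot-combine a b)
  ; ι-π = combine-remQuot {n G} (n H)
  ; adjacent⇒ = adjacent⇒ ; ⇒adjacent = ⇒adjacent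
  }
  where
  π₁ : Fin (n G * n H) → Fin (n G)
  π₁ x = proj₁ (remQuot {n G} (n H) x)
  π₂ : Fin (n G * n H) → Fin (n H)
  π₂ x = proj₂ (remQuot {n G} (n H) x)
  adjacent⇒ : ∀ {x y} → Adjacent (G □ H) x y →
    (π₁ x ≡ π₁ y × Adjacent H (π₂ x) (π₂ y)) ⊎ (π₂ x ≡ π₂ y × Adjacent G (π₁ x) (π₁ y))
  adjacent⇒ {x} {y} xy with ∨-true {does (π₁ x ≟ π₁ y) ∧ adj H (π₂ x) (π₂ y)} xy
  ... | inj₁ p with ∧-true {does (π₁ x ≟ π₁ y)} p
  ...   | same , adjacent = inj₁ (does-true⇒ (π₁ x ≟ π₁ y) same , adjacent)
  adjacent⇒ {x} {y} xy | inj₂ p with ∧-true {does (π₂ x ≟ π₂ y)} p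
  ...   | same , adjacent = inj₂ (does-true⇒ (π₂ x ≟ π₂ y) same , adjacent)
  ⇒adjacent : ∀ {x y} →
    (π₁ x ≡ π₁ y × Adjacent H (π₂ x) (π₂ y)) ⊎ (π₂ x ≡ π₂ y × Adjacent G (π₁ x) (π₁ y)) →
    Adjacent (G □ H) x y
  ⇒adjacent {x} {y} (inj₁ (same , adjacent)) =
    ∨-trueˡ _ (trans (cong (_∧ adj H (π₂ x) (π₂ y)) (dec-true (π₁ x ≟ π₁ y) same)) adjacent)
  ⇒adjacent {x} {y} (inj₂ (same , adjacent)) =
    ∨-trueʳ (does (π₁ x ≟ π₁ y) ∧ adj H (π₂ x) (π₂ y))
      (trans (cong (_∧ adj G (π₁ x) (π₁ y)) (dec-true (π₂ x ≟ π₂ y) same)) adjacent)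

module ProductProperties {Γ G H} (P : ProductOf Γ G H) (G-simple : IsSimple G) (H-simple : IsSimple H) where
  open ProductOf P

  π-injective : ∀ {x y} → π₁ x ≡ π₁ y → π₂ x ≡ π₂ y → x ≡ y
  π-injective {x} {y} p q = trans (≡.sym (ι-π x)) (trans (cong₂ ι p q) (ι-π y))

  ≡ι : ∀ {x a b} → π₁ x ≡ a → π₂ x ≡ b → x ≡ ι a b
  ≡ι {a = a} {b} p q = π-injective (trans p (≡.sym (π₁-ι a b))) (trans q (≡.sym (π₂-ι a b)))

  ι-injective : ∀ {a b c d} → ι a b ≡ ι c d → a ≡ c × b ≡ d
  ι-injective {a} {b} {c} {d} e =
    trans (≡.sym (π₁-ι a b)) (trans (cong π₁ e) (π₁-ι c d)) ,
    trans (≡.sym (π₂-ι a b)) (trans (cong π₂ e) (π₂-ι c d))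

  ι-adjacentʳ : ∀ a {b d} → Adjacent H b d → Adjacent Γ (ι a b) (ι a d)
  ι-adjacentʳ a {b} {d} bd = ⇒adjacent (inj₁ (trans (π₁-ι a b) (≡.sym (π₁-ι a d)) , adjacent))
    where
    adjacent : Adjacent H (π₂ (ι a b)) (π₂ (ι a d))
    adjacent rewrite π₂-ι a b | π₂-ι a d = bd

  ι-adjacentˡ : ∀ {a c} b → Adjacent G a c → Adjacent Γ (ι a b) (ι c b)
  ι-adjacentˡ {a} {c} b ac = ⇒adjacent (inj₂ (trans (π₂-ι a b) (≡.sym (π₂-ι c b)) , adjacent))
    where
    adjacent : Adjacent G (π₁ (ι a b)) (π₁ (ι c b))
    adjacent rewrite π₁-ι a b | π₁-ι c b = ac

  simple : IsSimple Γ
  simple = record { irrefl = λ x → ≢true⇒false (irreflexive x) ; sym = symmetric }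
    where
    irreflexive : ∀ x → ¬ Adjacent Γ x x
    irreflexive x xx with adjacent⇒ xx
    ... | inj₁ (_ , loop) = true≢false (trans (≡.sym loop) (irrefl H-simple (π₂ x)))
    ... | inj₂ (_ , loop) = true≢false (trans (≡.sym loop) (irrefl G-simple (π₁ x)))
    flip : ∀ {x y} → Adjacent Γ x y → Adjacent Γ y x
    flip xy with adjacent⇒ xy
    ... | inj₁ (p , q) = ⇒adjacent (inj₁ (≡.sym p , trans (sym H-simple _ _) q))
    ... | inj₂ (p , q) = ⇒adjacent (inj₂ (≡.sym p , trans (sym G-simple _ _) q))
    symmetric : ∀ x y → adj Γ x y ≡ adj Γ y x
    symmetric x y with adj Γ x y in xy | adj Γ y x in yx
    ... | true | true = refl
    ... | false | false = refl
    ... | true | false = ⊥-elim (true≢false (trans (≡.sym (flip xy)) yx))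
    ... | false | true = ⊥-elim (true≢false (trans (≡.sym (flip yx)) xy))

module TwoMaximalMatchings
  {Γ G H : Graph} (Γ-product : ProductOf Γ G H) (G-simple : IsSimple G) (H-simple : IsSimple H)
  {g₁ g₂ g₃ : Fin (n G)} {h₁ h₂ : Fin (n H)}
  (g₁g₂ : Adjacent G g₁ g₂) (g₂g₃ : Adjacent G g₂ g₃) (g₁≢g₃ : g₁ ≢ g₃) (h₁h₂ : Adjacent H h₁ h₂)
  (triangle⇒g₁g₃ : ∀ {h} → Adjacent H h h₁ → Adjacent H h h₂ → Adjacent G g₁ g₃)
  where

  open ProductOf Γ-product
  open ProductProperties Γ-product G-simple H-simple
  open EdgeSets Γ simple

  adjacentG⇒≢ : ∀ {a b} → Adjacent G a b → a ≢ b
  adjacentG⇒≢ = EdgeSets.adjacent⇒≢ G G-simple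

  adjacentH⇒≢ : ∀ {a b} → Adjacent H a b → a ≢ b
  adjacentH⇒≢ = EdgeSets.adjacent⇒≢ H H-simple

  InStrip : V → Set
  InStrip x = π₂ x ≡ h₁ ⊎ π₂ x ≡ h₂

  inStrip? : ∀ x → Dec (InStrip x)
  inStrip? x = (π₂ x ≟ h₁) ⊎-dec (π₂ x ≟ h₂)

  OnPath : Fin (n G) → Set
  OnPath a = a ≡ g₁ ⊎ a ≡ g₂ ⊎ a ≡ g₃

  onPath? : ∀ a → Dec (OnPath a)
  onPath? a = (a ≟ g₁) ⊎-dec (a ≟ g₂) ⊎-dec (a ≟ g₃)

  OffPathRung : V → V → Set
  OffPathRung x y = π₁ x ≡ π₁ y × Pair h₁ h₂ (π₂ x) (π₂ y) × ¬ OnPath (π₁ x)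

  offPathRung? : ∀ x y → Dec (OffPathRung x y)
  offPathRung? x y = (π₁ x ≟ π₁ y) ×-dec pair? h₁ h₂ (π₂ x) (π₂ y) ×-dec ¬? (onPath? (π₁ x))

  offPathRungs : EdgeSet Γ
  offPathRungs = edgesOf offPathRung?

  offPathRungs-isMatching : IsMatching offPathRungs
  offPathRungs-isMatching = edgesOf-isMatching offPathRung?
    (λ (p , q , r) → ≡.sym p , Pair-sym q , subst (λ a → ¬ OnPath a) p r)
    (λ (p , q , _) → ⇒adjacent (inj₁ (p , Pair-related (adj H) (sym H-simple) h₁h₂ q)))
    (λ (p , q , _) (p' , q' , _) → π-injective (trans (≡.sym p) p') (Pair-functional (adjacentH⇒≢ h₁h₂) q q'))

  covers-offPathRungs : ∀ {x} → Covers offPathRungs x → InStrip x × ¬ OnPath (π₁ x)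
  covers-offPathRungs {x} c with covers-edgesOf offPathRung? {x} c
  ... | _ , _ , inj₁ (p , _) , off = inj₁ p , off
  ... | _ , _ , inj₂ (p , _) , off = inj₂ p , off

  offPathRungs-covers : ∀ {x} → InStrip x → ¬ OnPath (π₁ x) → Covers offPathRungs x
  offPathRungs-covers {x} (inj₁ p) off =
    edgesOf-covers offPathRung? (≡.sym (π₁-ι _ _) , inj₁ (p , π₂-ι (π₁ x) h₂) , off)
  offPathRungs-covers {x} (inj₂ p) off =
    edgesOf-covers offPathRung? (≡.sym (π₁-ι _ _) , inj₂ (p , π₂-ι (π₁ x) h₁) , off)

  NearH₁ NearH₂ : Fin (n H) → Set
  NearH₁ h = Adjacent H h h₁ × h ≢ h₂
  NearH₂ h = Adjacent H h h₂ × h ≢ h₁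

  nearH₁? : ∀ h → Dec (NearH₁ h)
  nearH₁? h = (adj H h h₁ Bool.≟ true) ×-dec ¬? (h ≟ h₂)

  nearH₂? : ∀ h → Dec (NearH₂ h)
  nearH₂? h = (adj H h h₂ Bool.≟ true) ×-dec ¬? (h ≟ h₁)

  near₁-outside : ∀ {h} → NearH₁ h → ¬ (h ≡ h₁ ⊎ h ≡ h₂)
  near₁-outside (hh₁ , _) (inj₁ refl) = adjacentH⇒≢ hh₁ refl
  near₁-outside (_ , h≢h₂) (inj₂ p) = h≢h₂ p

  near₂-outside : ∀ {h} → NearH₂ h → ¬ (h ≡ h₁ ⊎ h ≡ h₂)
  near₂-outside (_ , h≢h₁) (inj₁ p) = h≢h₁ p
  near₂-outside (hh₂ , _) (inj₂ refl) = adjacentH⇒≢ hh₂ refl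

  -- In a layer h outside the strip, the edge that is matched in advance so that the
  -- corners (g₃,h₁) and (g₁,h₂), left uncovered by the staircase, have covered neighbours.
  BoundaryPair : Fin (n H) → Fin (n G) → Fin (n G) → Set
  BoundaryPair h a b = (NearH₁ h × ¬ NearH₂ h × Pair g₂ g₃ a b)
                     ⊎ (NearH₂ h × ¬ NearH₁ h × Pair g₁ g₂ a b)
                     ⊎ (NearH₁ h × NearH₂ h × Pair g₁ g₃ a b)

  boundaryPair? : ∀ h a b → Dec (BoundaryPair h a b)
  boundaryPair? h a b = (nearH₁? h ×-dec ¬? (nearH₂? h) ×-dec pair? g₂ g₃ a b)
                 ⊎-dec (nearH₂? h ×-dec ¬? (nearH₁? h) ×-dec pair? g₁ g₂ a b)
                 ⊎-dec (nearH₁? h ×-dec nearH₂? h ×-dec pair? g₁ g₃ a b)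

  BoundaryPair-sym : ∀ {h a b} → BoundaryPair h a b → BoundaryPair h b a
  BoundaryPair-sym (inj₁ (p , q , r)) = inj₁ (p , q , Pair-sym r)
  BoundaryPair-sym (inj₂ (inj₁ (p , q , r))) = inj₂ (inj₁ (p , q , Pair-sym r))
  BoundaryPair-sym (inj₂ (inj₂ (p , q , r))) = inj₂ (inj₂ (p , q , Pair-sym r))

  BoundaryPair-adjacent : ∀ {h a b} → BoundaryPair h a b → Adjacent G a b
  BoundaryPair-adjacent (inj₁ (_ , _ , r)) = Pair-related (adj G) (sym G-simple) g₂g₃ r
  BoundaryPair-adjacent (inj₂ (inj₁ (_ , _ , r))) = Pair-related (adj G) (sym G-simple) g₁g₂ r
  BoundaryPair-adjacent (inj₂ (inj₂ ((hh₁ , _) , (hh₂ , _) , r))) =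
    Pair-related (adj G) (sym G-simple) (triangle⇒g₁g₃ hh₁ hh₂) r

  BoundaryPair-functional : ∀ {h a b c} → BoundaryPair h a b → BoundaryPair h a c → b ≡ c
  BoundaryPair-functional (inj₁ (_ , _ , r)) (inj₁ (_ , _ , r')) = Pair-functional (adjacentG⇒≢ g₂g₃) r r'
  BoundaryPair-functional (inj₂ (inj₁ (_ , _ , r))) (inj₂ (inj₁ (_ , _ , r'))) = Pair-functional (adjacentG⇒≢ g₁g₂) r r'
  BoundaryPair-functional (inj₂ (inj₂ (_ , _ , r))) (inj₂ (inj₂ (_ , _ , r'))) = Pair-functional g₁≢g₃ r r'
  BoundaryPair-functional (inj₁ (_ , ¬n₂ , _)) (inj₂ (inj₁ (n₂ , _))) = ⊥-elim (¬n₂ n₂)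
  BoundaryPair-functional (inj₁ (_ , ¬n₂ , _)) (inj₂ (inj₂ (_ , n₂ , _))) = ⊥-elim (¬n₂ n₂)
  BoundaryPair-functional (inj₂ (inj₁ (_ , ¬n₁ , _))) (inj₁ (n₁ , _)) = ⊥-elim (¬n₁ n₁)
  BoundaryPair-functional (inj₂ (inj₁ (_ , ¬n₁ , _))) (inj₂ (inj₂ (n₁ , _))) = ⊥-elim (¬n₁ n₁)
  BoundaryPair-functional (inj₂ (inj₂ (_ , n₂ , _))) (inj₁ (_ , ¬n₂ , _)) = ⊥-elim (¬n₂ n₂)
  BoundaryPair-functional (inj₂ (inj₂ (n₁ , _))) (inj₂ (inj₁ (_ , ¬n₁ , _))) = ⊥-elim (¬n₁ n₁)

  BoundaryPair-outside : ∀ {h a b} → BoundaryPair h a b → ¬ (h ≡ h₁ ⊎ h ≡ h₂)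
  BoundaryPair-outside (inj₁ (n₁ , _)) = near₁-outside n₁
  BoundaryPair-outside (inj₂ (inj₁ (n₂ , _))) = near₂-outside n₂
  BoundaryPair-outside (inj₂ (inj₂ (n₁ , _))) = near₁-outside n₁

  BoundaryEdge : V → V → Set
  BoundaryEdge x y = π₂ x ≡ π₂ y × BoundaryPair (π₂ x) (π₁ x) (π₁ y)

  boundaryEdge? : ∀ x y → Dec (BoundaryEdge x y)
  boundaryEdge? x y = (π₂ x ≟ π₂ y) ×-dec boundaryPair? (π₂ x) (π₁ x) (π₁ y)

  boundaryEdges : EdgeSet Γ
  boundaryEdges = edgesOf boundaryEdge?

  boundaryEdges-isMatching : IsMatching boundaryEdges
  boundaryEdges-isMatching = edgesOf-isMatching boundaryEdge?
    (λ (p , q) → ≡.sym p , subst (λ h → BoundaryPair h _ _) p (BoundaryPair-sym q))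
    (λ (p , q) → ⇒adjacent (inj₂ (p , BoundaryPair-adjacent q)))
    (λ (p , q) (p' , q') → π-injective (BoundaryPair-functional q q') (trans (≡.sym p) p'))

  boundaryEdges-covers : ∀ {y g} → BoundaryPair (π₂ y) (π₁ y) g → Covers boundaryEdges y
  boundaryEdges-covers {y} {g} q =
    edgesOf-covers boundaryEdge?
      (≡.sym (π₂-ι g (π₂ y)) , subst (BoundaryPair (π₂ y) (π₁ y)) (≡.sym (π₁-ι g (π₂ y))) q)

  open GreedyOn (λ x → ¬ InStrip x) (λ x → ¬? (inStrip? x))

  boundaryEdges-within : Within boundaryEdges
  boundaryEdges-within x y e with does-true⇒ (boundaryEdge? x y) e
  ... | p , q = BoundaryPair-outside q , subst (λ h → ¬ (h ≡ h₁ ⊎ h ≡ h₂)) p (BoundaryPair-outside q)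

  module Outside = Extension (extend-to-maximalOn boundaryEdges-isMatching boundaryEdges-within)

  covers-outside : ∀ {x} → Covers Outside.edges x → ¬ InStrip x
  covers-outside {x} (covered e) = proj₁ (Outside.within x _ e)

  common : EdgeSet Γ
  common = offPathRungs ∪ Outside.edges

  common-isMatching : IsMatching common
  common-isMatching = ∪-isMatching offPathRungs-isMatching Outside.isMatching
    λ x c c' → covers-outside c' (proj₁ (covers-offPathRungs c))

  covers-common : ∀ {x} → Covers common x → InStrip x → ¬ OnPath (π₁ x)
  covers-common {x} c x∈strip with covers-∪ offPathRungs Outside.edges c
  ... | inj₁ c' = proj₂ (covers-offPathRungs c')
  ... | inj₂ c' = ⊥-elim (covers-outside c' x∈strip)

  disjoint-common : ∀ {F} → (∀ {x} → Covers F x → InStrip x × OnPath (π₁ x)) → Disjoint F common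
  disjoint-common covers-F x c c' with covers-F c
  ... | x∈strip , on = covers-common c' x∈strip on

  covers-ι-edge : ∀ {a b c d x} → Covers (edge (ι a b) (ι c d)) x →
                  (π₁ x ≡ a × π₂ x ≡ b) ⊎ (π₁ x ≡ c × π₂ x ≡ d)
  covers-ι-edge {a} {b} {c} {d} {x} cov with covers-edge (ι a b) (ι c d) cov
  ... | inj₁ refl = inj₁ (π₁-ι a b , π₂-ι a b)
  ... | inj₂ refl = inj₂ (π₁-ι c d , π₂-ι c d)

  ι-edge-coversˡ : ∀ {a b c d x} → π₁ x ≡ a → π₂ x ≡ b → Covers (edge (ι a b) (ι c d)) x
  ι-edge-coversˡ {a} {b} {c} {d} p q rewrite ≡ι p q = edge-coversˡ (ι a b) (ι c d)

  ι-edge-coversʳ : ∀ {a b c d x} → π₁ x ≡ c → π₂ x ≡ d → Covers (edge (ι a b) (ι c d)) x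
  ι-edge-coversʳ {a} {b} {c} {d} p q rewrite ≡ι p q = edge-coversʳ (ι a b) (ι c d)

  rung : Fin (n G) → EdgeSet Γ
  rung g = edge (ι g h₁) (ι g h₂)

  rung-isMatching : ∀ g → IsMatching (rung g)
  rung-isMatching g = edge-isMatching (ι-adjacentʳ g h₁h₂)

  size-rung : ∀ g → size Γ (rung g) ≡ 1
  size-rung g = size-edge λ e → adjacentH⇒≢ h₁h₂ (proj₂ (ι-injective e))

  covers-rung : ∀ {g x} → Covers (rung g) x → π₁ x ≡ g × InStrip x
  covers-rung c with covers-ι-edge c
  ... | inj₁ (p , q) = p , inj₁ q
  ... | inj₂ (p , q) = p , inj₂ q

  rung-covers : ∀ {g x} → π₁ x ≡ g → InStrip x → Covers (rung g) x
  rung-covers p (inj₁ q) = ι-edge-coversˡ p q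
  rung-covers p (inj₂ q) = ι-edge-coversʳ p q

  disjoint-rungs : ∀ {g g'} → g ≢ g' → Disjoint (rung g) (rung g')
  disjoint-rungs g≢g' x c c' = g≢g' (trans (≡.sym (proj₁ (covers-rung c))) (proj₁ (covers-rung c')))

  rungs : EdgeSet Γ
  rungs = rung g₁ ∪ (rung g₂ ∪ rung g₃)

  disjoint-rung₁ : Disjoint (rung g₁) (rung g₂ ∪ rung g₃)
  disjoint-rung₁ x c c' with covers-∪ (rung g₂) (rung g₃) c'
  ... | inj₁ c₂ = disjoint-rungs (adjacentG⇒≢ g₁g₂) x c c₂
  ... | inj₂ c₃ = disjoint-rungs g₁≢g₃ x c c₃

  rungs-isMatching : IsMatching rungs
  rungs-isMatching = ∪-isMatching (rung-isMatching g₁)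
    (∪-isMatching (rung-isMatching g₂) (rung-isMatching g₃) (disjoint-rungs (adjacentG⇒≢ g₂g₃)))
    disjoint-rung₁

  size-rungs : size Γ rungs ≡ 3
  size-rungs = begin
    size Γ rungs                                         ≡⟨ size-∪-disjoint _ _ disjoint-rung₁ ⟩
    size Γ (rung g₁) + size Γ (rung g₂ ∪ rung g₃)        ≡⟨ cong (size Γ (rung g₁) +_) (size-∪-disjoint _ _ (disjoint-rungs (adjacentG⇒≢ g₂g₃))) ⟩
    size Γ (rung g₁) + (size Γ (rung g₂) + size Γ (rung g₃)) ≡⟨ cong₂ _+_ (size-rung g₁) (cong₂ _+_ (size-rung g₂) (size-rung g₃)) ⟩
    3                                                    ∎
    where open ≡-Reasoning

  covers-rungs : ∀ {x} → Covers rungs x → InStrip x × OnPath (π₁ x)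
  covers-rungs c with covers-∪ (rung g₁) (rung g₂ ∪ rung g₃) c
  ... | inj₁ c₁ = proj₂ (covers-rung c₁) , inj₁ (proj₁ (covers-rung c₁))
  ... | inj₂ c' with covers-∪ (rung g₂) (rung g₃) c'
  ...   | inj₁ c₂ = proj₂ (covers-rung c₂) , inj₂ (inj₁ (proj₁ (covers-rung c₂)))
  ...   | inj₂ c₃ = proj₂ (covers-rung c₃) , inj₂ (inj₂ (proj₁ (covers-rung c₃)))

  rungs-covers : ∀ {x} → InStrip x → OnPath (π₁ x) → Covers rungs x
  rungs-covers s (inj₁ p) = covers-∪ˡ (rung g₁) _ (rung-covers p s)
  rungs-covers s (inj₂ (inj₁ p)) = covers-∪ʳ (rung g₁) _ (covers-∪ˡ (rung g₂) (rung g₃) (rung-covers p s))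
  rungs-covers s (inj₂ (inj₂ p)) = covers-∪ʳ (rung g₁) _ (covers-∪ʳ (rung g₂) (rung g₃) (rung-covers p s))

  stepˡ stepʳ staircase : EdgeSet Γ
  stepˡ = edge (ι g₁ h₁) (ι g₂ h₁)
  stepʳ = edge (ι g₂ h₂) (ι g₃ h₂)
  staircase = stepˡ ∪ stepʳ

  disjoint-steps : Disjoint stepˡ stepʳ
  disjoint-steps x c c' with covers-ι-edge c | covers-ι-edge c'
  ... | inj₁ (_ , p) | inj₁ (_ , q) = adjacentH⇒≢ h₁h₂ (trans (≡.sym p) q)
  ... | inj₁ (_ , p) | inj₂ (_ , q) = adjacentH⇒≢ h₁h₂ (trans (≡.sym p) q)
  ... | inj₂ (_ , p) | inj₁ (_ , q) = adjacentH⇒≢ h₁h₂ (trans (≡.sym p) q)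
  ... | inj₂ (_ , p) | inj₂ (_ , q) = adjacentH⇒≢ h₁h₂ (trans (≡.sym p) q)

  staircase-isMatching : IsMatching staircase
  staircase-isMatching =
    ∪-isMatching (edge-isMatching (ι-adjacentˡ h₁ g₁g₂)) (edge-isMatching (ι-adjacentˡ h₂ g₂g₃)) disjoint-steps

  size-staircase : size Γ staircase ≡ 2
  size-staircase = trans (size-∪-disjoint stepˡ stepʳ disjoint-steps)
    (cong₂ _+_ (size-edge (λ e → adjacentG⇒≢ g₁g₂ (proj₁ (ι-injective e))))
               (size-edge (λ e → adjacentG⇒≢ g₂g₃ (proj₁ (ι-injective e)))))

  covers-staircase : ∀ {x} → Covers staircase x → InStrip x × OnPath (π₁ x)
  covers-staircase c with covers-∪ stepˡ stepʳ c
  ... | inj₁ c' with covers-ι-edge c'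
  ...   | inj₁ (p , q) = inj₁ q , inj₁ p
  ...   | inj₂ (p , q) = inj₁ q , inj₂ (inj₁ p)
  covers-staircase c | inj₂ c' with covers-ι-edge c'
  ...   | inj₁ (p , q) = inj₂ q , inj₂ (inj₁ p)
  ...   | inj₂ (p , q) = inj₂ q , inj₂ (inj₂ p)

  Corner : V → Set
  Corner x = (π₁ x ≡ g₃ × π₂ x ≡ h₁) ⊎ (π₁ x ≡ g₁ × π₂ x ≡ h₂)

  corner? : ∀ x → Dec (Corner x)
  corner? x = ((π₁ x ≟ g₃) ×-dec (π₂ x ≟ h₁)) ⊎-dec ((π₁ x ≟ g₁) ×-dec (π₂ x ≟ h₂))

  staircase-covers : ∀ {x} → InStrip x → OnPath (π₁ x) → ¬ Corner x → Covers staircase x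
  staircase-covers (inj₁ q) (inj₁ p) _ = covers-∪ˡ stepˡ stepʳ (ι-edge-coversˡ p q)
  staircase-covers (inj₁ q) (inj₂ (inj₁ p)) _ = covers-∪ˡ stepˡ stepʳ (ι-edge-coversʳ p q)
  staircase-covers (inj₁ q) (inj₂ (inj₂ p)) ¬corner = ⊥-elim (¬corner (inj₁ (p , q)))
  staircase-covers (inj₂ q) (inj₁ p) ¬corner = ⊥-elim (¬corner (inj₂ (p , q)))
  staircase-covers (inj₂ q) (inj₂ (inj₁ p)) _ = covers-∪ʳ stepˡ stepʳ (ι-edge-coversˡ p q)
  staircase-covers (inj₂ q) (inj₂ (inj₂ p)) _ = covers-∪ʳ stepˡ stepʳ (ι-edge-coversʳ p q)

  corners-nonadjacent : ∀ {x y} → Corner x → Corner y → ¬ Adjacent Γ x y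
  corners-nonadjacent (inj₁ (p , q)) (inj₁ (p' , q')) xy =
    adjacent⇒≢ xy (π-injective (trans p (≡.sym p')) (trans q (≡.sym q')))
  corners-nonadjacent (inj₂ (p , q)) (inj₂ (p' , q')) xy =
    adjacent⇒≢ xy (π-injective (trans p (≡.sym p')) (trans q (≡.sym q')))
  corners-nonadjacent (inj₁ (p , q)) (inj₂ (p' , q')) xy with adjacent⇒ xy
  ... | inj₁ (same , _) = g₁≢g₃ (trans (≡.sym p') (trans (≡.sym same) p))
  ... | inj₂ (same , _) = adjacentH⇒≢ h₁h₂ (trans (≡.sym q) (trans same q'))
  corners-nonadjacent (inj₂ (p , q)) (inj₁ (p' , q')) xy with adjacent⇒ xy
  ... | inj₁ (same , _) = g₁≢g₃ (trans (≡.sym p) (trans same p'))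
  ... | inj₂ (same , _) = adjacentH⇒≢ h₁h₂ (trans (≡.sym q') (trans (≡.sym same) q))

  leaving-strip : ∀ {x y} → InStrip x → Adjacent Γ x y → ¬ InStrip y → π₁ y ≡ π₁ x × Adjacent H (π₂ y) (π₂ x)
  leaving-strip {x} {y} sx xy ¬sy with adjacent⇒ xy
  ... | inj₁ (same , adjacent) = ≡.sym same , trans (sym H-simple (π₂ y) (π₂ x)) adjacent
  ... | inj₂ (same , _) = ⊥-elim (¬sy (subst (λ h → h ≡ h₁ ⊎ h ≡ h₂) same sx))

  near₁-covered : ∀ {y} → π₁ y ≡ g₃ → NearH₁ (π₂ y) → Covers boundaryEdges y
  near₁-covered {y} column n₁ with nearH₂? (π₂ y)
  ... | no ¬n₂ = boundaryEdges-covers (inj₁ (n₁ , ¬n₂ , inj₂ (column , refl)))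
  ... | yes n₂ = boundaryEdges-covers (inj₂ (inj₂ (n₁ , n₂ , inj₂ (column , refl))))

  near₂-covered : ∀ {y} → π₁ y ≡ g₁ → NearH₂ (π₂ y) → Covers boundaryEdges y
  near₂-covered {y} column n₂ with nearH₁? (π₂ y)
  ... | no ¬n₁ = boundaryEdges-covers (inj₂ (inj₁ (n₂ , ¬n₁ , inj₁ (column , refl))))
  ... | yes n₁ = boundaryEdges-covers (inj₂ (inj₂ (n₁ , n₂ , inj₁ (column , refl))))

  corner-neighbour-covered : ∀ {x y} → Corner x → Adjacent Γ x y → ¬ InStrip y → Covers boundaryEdges y
  corner-neighbour-covered {y = y} (inj₁ (p , q)) xy ¬sy with leaving-strip (inj₁ q) xy ¬sy
  ... | column , yx = near₁-covered (trans column p) (subst (Adjacent H (π₂ y)) q yx , λ e → ¬sy (inj₂ e))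
  corner-neighbour-covered {y = y} (inj₂ (p , q)) xy ¬sy with leaving-strip (inj₂ q) xy ¬sy
  ... | column , yx = near₂-covered (trans column p) (subst (Adjacent H (π₂ y)) q yx , λ e → ¬sy (inj₁ e))

  module WithCommon {F : EdgeSet Γ} (F-isMatching : IsMatching F)
    (covers-F : ∀ {x} → Covers F x → InStrip x × OnPath (π₁ x)) where

    M : EdgeSet Γ
    M = F ∪ common

    M-isMatching : IsMatching M
    M-isMatching = ∪-isMatching F-isMatching common-isMatching (disjoint-common covers-F)

    size-M : size Γ M ≡ size Γ F + size Γ common
    size-M = size-∪-disjoint F common (disjoint-common covers-F)

    strip-covered : ∀ {x} → (OnPath (π₁ x) → Covers F x) → InStrip x → Covers M x
    strip-covered {x} F-covers sx with onPath? (π₁ x)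
    ... | yes on = covers-∪ˡ F common (F-covers on)
    ... | no off = covers-∪ʳ F common (covers-∪ˡ offPathRungs Outside.edges (offPathRungs-covers sx off))

    outside-covered : ∀ {x} → Covers Outside.edges x → Covers M x
    outside-covered c = covers-∪ʳ F common (covers-∪ʳ offPathRungs Outside.edges c)

    outside-maximal : ∀ {x y} → ¬ InStrip x → ¬ InStrip y → Adjacent Γ x y → Covers M x ⊎ Covers M y
    outside-maximal {x} {y} ¬sx ¬sy xy with Outside.property x y ¬sx ¬sy xy
    ... | inj₁ c = inj₁ (outside-covered c)
    ... | inj₂ c = inj₂ (outside-covered c)

  module M₃ = WithCommon rungs-isMatching covers-rungs
  module M₂ = WithCommon staircase-isMatching covers-staircase

  M₃-maximal : Maximal M₃.M
  M₃-maximal x y xy with inStrip? x | inStrip? y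
  ... | yes sx | _ = inj₁ (M₃.strip-covered (rungs-covers sx) sx)
  ... | no _ | yes sy = inj₂ (M₃.strip-covered (rungs-covers sy) sy)
  ... | no ¬sx | no ¬sy = M₃.outside-maximal ¬sx ¬sy xy

  data Position (x : V) : Set where
    inner  : InStrip x → ¬ Corner x → Position x
    corner : Corner x → Position x
    outer  : ¬ InStrip x → Position x

  position : ∀ x → Position x
  position x with corner? x | inStrip? x
  ... | yes c | _ = corner c
  ... | no ¬c | yes s = inner s ¬c
  ... | no _ | no ¬s = outer ¬s

  M₂-maximal : Maximal M₂.M
  M₂-maximal x y xy with position x | position y
  ... | inner sx ¬cx | _ = inj₁ (M₂.strip-covered (λ on → staircase-covers sx on ¬cx) sx)
  ... | _ | inner sy ¬cy = inj₂ (M₂.strip-covered (λ on → staircase-covers sy on ¬cy) sy)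
  ... | corner cx | corner cy = ⊥-elim (corners-nonadjacent cx cy xy)
  ... | corner cx | outer ¬sy =
    inj₂ (M₂.outside-covered (covers-mono Outside.extends (corner-neighbour-covered cx xy ¬sy)))
  ... | outer ¬sx | corner cy =
    inj₁ (M₂.outside-covered (covers-mono Outside.extends (corner-neighbour-covered cy (trans (sym simple y x) xy) ¬sx)))
  ... | outer ¬sx | outer ¬sy = M₂.outside-maximal ¬sx ¬sy xy

  not-wellEdgeDominated : ¬ WellEdgeDominated Γ
  not-wellEdgeDominated wed = 3≢2 (+-cancelʳ-≡ (size Γ common) 3 2 sizes)
    where
    3≢2 : 3 ≢ 2
    3≢2 ()
    sizes : 3 + size Γ common ≡ 2 + size Γ common
    sizes = begin
      3 + size Γ common                ≡⟨ cong (_+ size Γ common) size-rungs ⟨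
      size Γ rungs + size Γ common     ≡⟨ M₃.size-M ⟨
      size Γ M₃.M                      ≡⟨ wed M₃.M M₂.M (maximalMatching⇒minimalEDS M₃.M-isMatching M₃-maximal)
                                                        (maximalMatching⇒minimalEDS M₂.M-isMatching M₂-maximal) ⟩
      size Γ M₂.M                      ≡⟨ M₂.size-M ⟩
      size Γ staircase + size Γ common ≡⟨ cong (_+ size Γ common) size-staircase ⟩
      2 + size Γ common                ∎
      where open ≡-Reasoning

record Path₃ (K : Graph) : Set where
  constructor path₃
  field
    {start middle end} : Fin (n K)
    first    : Adjacent K start middle
    second   : Adjacent K middle end
    distinct : start ≢ end

path×edge⇒not-wellEdgeDominated : ∀ {Γ G H} → ProductOf Γ G H → IsSimple G → IsSimple H →
  Path₃ G → ∃₂ (Adjacent H) → ¬ WellEdgeDominated Γ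
path×edge⇒not-wellEdgeDominated {H = H} P G-simple H-simple
  (path₃ {g₁} {g₂} {g₃} g₁g₂ g₂g₃ g₁≢g₃) (h₁ , h₂ , h₁h₂)
  with any? (λ h → (adj H h h₁ Bool.≟ true) ×-dec (adj H h h₂ Bool.≟ true))
... | yes (h , hh₁ , hh₂) =
  TwoMaximalMatchings.not-wellEdgeDominated (ProductOf-swap P) H-simple G-simple
    (trans (sym H-simple h₁ h) hh₁) hh₂ (EdgeSets.adjacent⇒≢ H H-simple h₁h₂) g₁g₂ (λ _ _ → h₁h₂)
... | no no-triangle =
  TwoMaximalMatchings.not-wellEdgeDominated P G-simple H-simple g₁g₂ g₂g₃ g₁≢g₃ h₁h₂
    (λ {h} hh₁ hh₂ → ⊥-elim (no-triangle (h , hh₁ , hh₂)))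

distinct-pair : ∀ {m} → m ≥ 2 → Σ (Fin m) λ a → Σ (Fin m) λ b → a ≢ b
distinct-pair {suc (suc _)} _ = zero , suc zero , λ ()
distinct-pair {suc zero} (s≤s ())

avoid-two : ∀ {m} → m ≥ 3 → (x y : Fin m) → ∃[ w ] (w ≢ x × w ≢ y)
avoid-two {suc zero} (s≤s ()) x y
avoid-two {suc (suc zero)} (s≤s (s≤s ())) x y
avoid-two {suc (suc (suc _))} _ x y with zero ≟ x | zero ≟ y
... | no 0≢x | no 0≢y = zero , 0≢x , 0≢y
... | yes refl | _ with suc zero ≟ y
...   | no 1≢y = suc zero , (λ ()) , 1≢y
...   | yes refl = suc (suc zero) , (λ ()) , (λ ())
avoid-two {suc (suc (suc _))} _ x y | no _ | yes refl with suc zero ≟ x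
...   | no 1≢x = suc zero , 1≢x , (λ ())
...   | yes refl = suc (suc zero) , (λ ()) , (λ ())

module ConnectedGraph (K : Graph) (K-simple : IsSimple K) (K-connected : Connected K) where
  open EdgeSets K K-simple using (V; adjacent⇒≢)

  first-step : ∀ {u v} → u ≢ v → Star (Adjacent K) u v → ∃[ w ] Adjacent K u w
  first-step u≢v ε = ⊥-elim (u≢v refl)
  first-step u≢v (uw ◅ _) = _ , uw

  -- Walk from x towards w: the first step away from the edge xy extends it to a path.
  path₃-towards : ∀ {x y w} → Adjacent K x y → Star (Adjacent K) x w → w ≢ x → w ≢ y → Path₃ K
  path₃-towards xy ε w≢x w≢y = ⊥-elim (w≢x refl)
  path₃-towards {x} {y} xy (_◅_ {j = z} xz walk) w≢x w≢y with z ≟ y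
  ... | no z≢y = path₃ (trans (sym K-simple y x) xy) xz λ y≡z → z≢y (≡.sym y≡z)
  ... | yes refl = path₃-towards (trans (sym K-simple z x) xy) walk w≢y w≢x

  some-edge : n K ≥ 2 → ∃₂ (Adjacent K)
  some-edge n≥2 with a , b , a≢b ← distinct-pair n≥2 = a , first-step a≢b (K-connected a b)

  some-path₃ : n K ≥ 3 → Path₃ K
  some-path₃ n≥3 with x , y , xy ← some-edge (≤-trans (n≤1+n 2) n≥3) with w , w≢x , w≢y ← avoid-two n≥3 x y
    = path₃-towards xy (K-connected x w) w≢x w≢y

module _ {N : ℕ} {A A' : Fin N → Fin N → Bool} (A≗A' : ∀ x y → A x y ≡ A' x y) where

  private
    Γ Γ' : Graph
    Γ = mkGraph N A
    Γ' = mkGraph N A'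

    isEdgeSet← : ∀ {F} → IsEdgeSet Γ' F → IsEdgeSet Γ F
    isEdgeSet← F-edges = record
      { sub = λ u v p → trans (A≗A' u v) (IsEdgeSet.sub F-edges u v p) ; sym = IsEdgeSet.sym F-edges }

    isEdgeSet→ : ∀ {F} → IsEdgeSet Γ F → IsEdgeSet Γ' F
    isEdgeSet→ F-edges = record
      { sub = λ u v p → trans (≡.sym (A≗A' u v)) (IsEdgeSet.sub F-edges u v p) ; sym = IsEdgeSet.sym F-edges }

    isEDS← : ∀ {F} → IsEDS Γ' F → IsEDS Γ F
    isEDS← {F} (F-edges , dominating) = isEdgeSet← {F} F-edges , λ u v uv → dominating u v (trans (≡.sym (A≗A' u v)) uv)

    isEDS→ : ∀ {F} → IsEDS Γ F → IsEDS Γ' F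
    isEDS→ {F} (F-edges , dominating) = isEdgeSet→ {F} F-edges , λ u v uv → dominating u v (trans (A≗A' u v) uv)

    isMinimalEDS→ : ∀ {F} → IsMinimalEDS Γ F → IsMinimalEDS Γ' F
    isMinimalEDS→ {F} (eds , minimal) =
      isEDS→ {F} eds , λ F' F'-edges F'⊆F F'≢F eds' → minimal F' (isEdgeSet← {F'} F'-edges) F'⊆F F'≢F (isEDS← {F'} eds')

  wellEdgeDominated-cong : WellEdgeDominated Γ' → WellEdgeDominated Γ
  wellEdgeDominated-cong wed F F' m m' = wed F F' (isMinimalEDS→ {F} m) (isMinimalEDS→ {F'} m')

isMinimalEDS-cong : ∀ Γ {F F'} → (∀ u v → F u v ≡ F' u v) → IsMinimalEDS Γ F → IsMinimalEDS Γ F'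
isMinimalEDS-cong Γ {F} {F'} F≗F' ((F-edges , dominating) , minimal) = (F'-edges , dominating') , minimal'
  where
  F'-edges : IsEdgeSet Γ F'
  F'-edges = record
    { sub = λ u v p → IsEdgeSet.sub F-edges u v (trans (F≗F' u v) p)
    ; sym = λ u v → trans (≡.sym (F≗F' u v)) (trans (IsEdgeSet.sym F-edges u v) (F≗F' v u)) }
  dominating' : ∀ u v → Adjacent Γ u v → F' u v ≡ false → ∃[ w ] (F' u w ≡ true ⊎ F' v w ≡ true)
  dominating' u v uv F'uv with dominating u v uv (trans (F≗F' u v) F'uv)
  ... | w , inj₁ p = w , inj₁ (trans (≡.sym (F≗F' u w)) p)
  ... | w , inj₂ p = w , inj₂ (trans (≡.sym (F≗F' v w)) p)
  minimal' : ∀ F'' → IsEdgeSet Γ F'' → _⊆E_ {Γ} F'' F' → ¬ (∀ u v → F'' u v ≡ F' u v) → ¬ IsEDS Γ F''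
  minimal' F'' F''-edges F''⊆F' F''≢F' = minimal F'' F''-edges (λ u v p → trans (F≗F' u v) (F''⊆F' u v p))
    (λ F''≗F → F''≢F' λ u v → trans (F''≗F u v) (F≗F' u v))

K₂-adjacency : ∀ {a} → IsSimple (mkGraph 2 a) → Connected (mkGraph 2 a) → ∀ u v → a u v ≡ not (does (u ≟ v))
K₂-adjacency s c 0F 0F = irrefl s 0F
K₂-adjacency s c 1F 1F = irrefl s 1F
K₂-adjacency {a} s c 0F 1F with ConnectedGraph.first-step _ s c {0F} {1F} (λ ()) (c 0F 1F)
... | 0F , loop = ⊥-elim (true≢false (trans (≡.sym loop) (irrefl s 0F)))
... | 1F , adjacent = adjacent
K₂-adjacency s c 1F 0F = trans (sym s 1F 0F) (K₂-adjacency s c 0F 1F)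

≅K₂ : ∀ K → IsSimple K → Connected K → n K ≡ 2 → K ≅ K₂
≅K₂ (mkGraph _ a) s c refl = ↔-id _ , λ u v → ≡.sym (K₂-adjacency s c u v)

C₄ : Graph
C₄ = K₂ □ K₂

-- Vertex x of K₂ □ K₂ is (x div 2, x mod 2), so C₄ is the cycle 0 - 1 - 3 - 2 - 0.
cycleEdges : Bool → Bool → Bool → Bool → EdgeSet C₄
cycleEdges e₀₁ e₀₂ e₁₃ e₂₃ = F
  where
  F : EdgeSet C₄
  F 0F 1F = e₀₁
  F 1F 0F = e₀₁
  F 0F 2F = e₀₂
  F 2F 0F = e₀₂
  F 1F 3F = e₁₃
  F 3F 1F = e₁₃
  F 2F 3F = e₂₃
  F 3F 2F = e₂₃
  F _ _ = false

cycleEdges-complete : ∀ F → IsEdgeSet C₄ F → ∀ x y →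
  F x y ≡ cycleEdges (F 0F 1F) (F 0F 2F) (F 1F 3F) (F 2F 3F) x y
cycleEdges-complete F F-edges = go
  where
  absent : ∀ x y → adj C₄ x y ≡ false → F x y ≡ false
  absent x y nonadjacent = ≢true⇒false λ p → true≢false (trans (≡.sym (IsEdgeSet.sub F-edges x y p)) nonadjacent)
  flip : ∀ x y → F x y ≡ F y x
  flip = IsEdgeSet.sym F-edges
  go : ∀ x y → F x y ≡ cycleEdges _ _ _ _ x y
  go 0F zero = absent _ _ refl
  go 0F 1F = refl
  go 0F 2F = refl
  go 0F 3F = absent _ _ refl
  go 1F 0F = flip _ _
  go 1F 1F = absent _ _ refl
  go 1F 2F = absent _ _ refl
  go 1F 3F = refl
  go 2F 0F = flip _ _
  go 2F 1F = absent _ _ refl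
  go 2F 2F = absent _ _ refl
  go 2F 3F = refl
  go 3F 0F = absent _ _ refl
  go 3F 1F = flip _ _
  go 3F 2F = flip _ _
  go 3F 3F = absent _ _ refl

isEdgeSet? : (F : EdgeSet C₄) → Dec ((∀ u v → F u v ≡ true → adj C₄ u v ≡ true) × (∀ u v → F u v ≡ F v u))
isEdgeSet? F = all? (λ u → all? λ v → (F u v Bool.≟ true) →-dec (adj C₄ u v Bool.≟ true))
         ×-dec all? (λ u → all? λ v → F u v Bool.≟ F v u)

dominating? : (F : EdgeSet C₄) →
  Dec (∀ u v → adj C₄ u v ≡ true → F u v ≡ false → ∃[ w ] (F u w ≡ true ⊎ F v w ≡ true))
dominating? F = all? λ u → all? λ v → (adj C₄ u v Bool.≟ true) →-dec (F u v Bool.≟ false) →-dec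
                  any? λ w → (F u w Bool.≟ true) ⊎-dec (F v w Bool.≟ true)

⊆? : (F F' : EdgeSet C₄) → Dec (_⊆E_ {C₄} F F')
⊆? F F' = all? λ u → all? λ v → (F u v Bool.≟ true) →-dec (F' u v Bool.≟ true)

≗? : (F F' : EdgeSet C₄) → Dec (∀ u v → F u v ≡ F' u v)
≗? F F' = all? λ u → all? λ v → F u v Bool.≟ F' u v

isEDS : (F : EdgeSet C₄) → True (isEdgeSet? F) → True (dominating? F) → IsEDS C₄ F
isEDS F edges dominating with sub , sym ← toWitness {a? = isEdgeSet? F} edges =
  record { sub = sub ; sym = sym } , toWitness {a? = dominating? F} dominating

not-minimal : ∀ {F} → IsMinimalEDS C₄ F → (F' : EdgeSet C₄) →
              True (isEdgeSet? F') → True (dominating? F') → True (⊆? F' F) → False (≗? F' F) → ⊥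
not-minimal (_ , minimal) F' edges dominating F'⊆F F'≢F =
  minimal F' (proj₁ (isEDS F' edges dominating)) (toWitness F'⊆F) (toWitnessFalse F'≢F) (isEDS F' edges dominating)

not-dominating : ∀ {F} → IsMinimalEDS C₄ F → False (dominating? F) → ⊥
not-dominating ((_ , dominating) , _) undominated = toWitnessFalse undominated dominating

size-minimal-cycleEdges : ∀ e₀₁ e₀₂ e₁₃ e₂₃ → IsMinimalEDS C₄ (cycleEdges e₀₁ e₀₂ e₁₃ e₂₃) →
                          size C₄ (cycleEdges e₀₁ e₀₂ e₁₃ e₂₃) ≡ 2
size-minimal-cycleEdges true true true true m = ⊥-elim (not-minimal m (cycleEdges true false false true) tt tt tt tt)
size-minimal-cycleEdges true true true false m = ⊥-elim (not-minimal m (cycleEdges true true false false) tt tt tt tt)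
size-minimal-cycleEdges true true false true m = ⊥-elim (not-minimal m (cycleEdges true true false false) tt tt tt tt)
size-minimal-cycleEdges true false true true m = ⊥-elim (not-minimal m (cycleEdges true false true false) tt tt tt tt)
size-minimal-cycleEdges false true true true m = ⊥-elim (not-minimal m (cycleEdges false true true false) tt tt tt tt)
size-minimal-cycleEdges true true false false m = refl
size-minimal-cycleEdges true false true false m = refl
size-minimal-cycleEdges true false false true m = refl
size-minimal-cycleEdges false true true false m = refl
size-minimal-cycleEdges false true false true m = refl
size-minimal-cycleEdges false false true true m = refl
size-minimal-cycleEdges true false false false m = ⊥-elim (not-dominating m tt)
size-minimal-cycleEdges false true false false m = ⊥-elim (not-dominating m tt)
size-minimal-cycleEdges false false true false m = ⊥-elim (not-dominating m tt)
size-minimal-cycleEdges false false false true m = ⊥-elim (not-dominating m tt)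
size-minimal-cycleEdges false false false false m = ⊥-elim (not-dominating m tt)

K₂-simple : IsSimple K₂
K₂-simple = record { irrefl = λ { 0F → refl ; 1F → refl } ; sym = symmetric }
  where
  symmetric : ∀ u v → adj K₂ u v ≡ adj K₂ v u
  symmetric 0F 0F = refl
  symmetric 0F 1F = refl
  symmetric 1F 0F = refl
  symmetric 1F 1F = refl

C₄-simple : IsSimple C₄
C₄-simple = ProductProperties.simple (□-product K₂ K₂) K₂-simple K₂-simple

C₄-wellEdgeDominated : WellEdgeDominated C₄
C₄-wellEdgeDominated F F' m m' = trans (size-minimal F m) (≡.sym (size-minimal F' m'))
  where
  size-minimal : ∀ F → IsMinimalEDS C₄ F → size C₄ F ≡ 2
  size-minimal F m = trans (EdgeSets.size-cong C₄ C₄-simple F≗cycle)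
                            (size-minimal-cycleEdges _ _ _ _ (isMinimalEDS-cong C₄ F≗cycle m))
    where
    F≗cycle = cycleEdges-complete F (proj₁ (proj₁ m))

K₂□K₂-wellEdgeDominated : ∀ G H → IsSimple G → IsSimple H → Connected G → Connected H →
  G ≅ K₂ → H ≅ K₂ → WellEdgeDominated (G □ H)
K₂□K₂-wellEdgeDominated G H G-simple H-simple G-connected H-connected (G↔K₂ , _) (H↔K₂ , _)
  with ↔⇒≡ G↔K₂ | ↔⇒≡ H↔K₂
... | refl | refl = wellEdgeDominated-cong adj≗ C₄-wellEdgeDominated
  where
  adj≗ : ∀ x y → adj (G □ H) x y ≡ adj C₄ x y
  adj≗ x y = cong₂ _∨_
    (cong (does (π₁ x ≟ π₁ y) ∧_) (K₂-adjacency H-simple H-connected (π₂ x) (π₂ y)))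
    (cong (does (π₂ x ≟ π₂ y) ∧_) (K₂-adjacency G-simple G-connected (π₁ x) (π₁ y)))
    where open ProductOf (□-product G H)

theorem2 : (G H : Graph) → IsSimple G → IsSimple H →
    Connected G → Connected H → n G ≥ 2 → n H ≥ 2 →
    (WellEdgeDominated (G □ H) ⇔ ((G ≅ K₂) × (H ≅ K₂)))
theorem2 G H G-simple H-simple G-connected H-connected G≥2 H≥2 = mk⇔ forward backward
  where
  open ConnectedGraph G G-simple G-connected renaming (some-edge to G-edge; some-path₃ to G-path₃)
  open ConnectedGraph H H-simple H-connected renaming (some-edge to H-edge; some-path₃ to H-path₃)
  forward : WellEdgeDominated (G □ H) → (G ≅ K₂) × (H ≅ K₂)
  forward wed with n G Nat.≟ 2 | n H Nat.≟ 2
  ... | yes G≡2 | yes H≡2 = ≅K₂ G G-simple G-connected G≡2 , ≅K₂ H H-simple H-connected H≡2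
  ... | no G≢2 | _ = ⊥-elim (path×edge⇒not-wellEdgeDominated (□-product G H) G-simple H-simple
                               (G-path₃ (≤∧≢⇒< G≥2 (≢-sym G≢2))) (H-edge H≥2) wed)
  ... | _ | no H≢2 = ⊥-elim (path×edge⇒not-wellEdgeDominated (ProductOf-swap (□-product G H)) H-simple G-simple
                               (H-path₃ (≤∧≢⇒< H≥2 (≢-sym H≢2))) (G-edge G≥2) wed)
  backward : (G ≅ K₂) × (H ≅ K₂) → WellEdgeDominated (G □ H)
  backward (G≅K₂ , H≅K₂) = K₂□K₂-wellEdgeDominated G H G-simple H-simple G-connected H-connected G≅K₂ H≅K₂
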